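{- For any integers $m,m'\ge 0$ and $t=m+m'$, the augmented Plancherel growth processes initiated at times $m$ and $m'$ satisfy \[ \Lambda_m^{(t)}\overset{d}{=}\left[\Lambda_{m'}^{(t)}\right]^T, \] where for an augmented Young diagram $\Lambda=(\lambda,(x,y))$ its transpose is $\Lambda^T=(\lambda^T,(y,x))$, $\lambda^T$ denoting the transposed (conjugate) Young diagram.
   Context: Boxes are identified with coordinates $(x,y)\in\mathbb{N}_0^2$ of their lower-left corners ($x$ = column, $y$ = row, row $0$ at the bottom). Schensted row insertion $\mathcal{T}\leftarrow a$: $a$ is inserted into row $0$ into the leftmost box with entry strictly bigger than $a$; if none, $a$ goes into the leftmost empty box of the row and the procedure stops; otherwise the previous content is bumped into row $1$ and inserted there by the same rule, etc. $P(w_1,\dots,w_\ell)=(\cdots(\emptyset\leftarrow w_1)\cdots)\leftarrow w_\ell$. An augmented Young diagram is a pair $(\lambda,\Box)$ of a Young diagram $\lambda$ and an outer corner $\Box$ of $\lambda$ (a box not in $\lambda$ whose addition gives a Young diagram). Let $\xi_1,\xi_2,\dots$ be i.i.d. uniform on $[0,1]$ and $\infty$ a symbol bigger than all $\xi_i$. For a tableau $\mathcal{T}$ with exactly one entry $\infty$, $\operatorname{sh}^*\mathcal{T}=(\text{shape of }\mathcal{T}\text{ with the box of }\infty\text{ removed},\ \text{position of the box of }\infty)$. The augmented Plancherel growth process initiated at time $m$ is $\Lambda_m^{(t)}=\operatorname{sh}^*P(\xi_1,\dots,\xi_m,\infty,\xi_{m+1},\dots,\xi_t)$, $t\ge m$.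 -}

module Defs where

open import Data.Nat using (ℕ; zero; suc; _<ᵇ_)
open import Data.Bool using (Bool; true; false; not; if_then_else_)
open import Data.List using (List; []; _∷_; map; length; filter; foldl; concatMap; take; drop; _++_; upTo)
open import Data.Maybe using (Maybe; just; nothing)
open import Data.Product using (_×_; _,_)
open import Relation.Nullary.Decidable using (T?)

-- Entries of tableaux: finite values (the relative order of ξ's, encoded
-- by a permutation of 0..t-1) and the symbol ∞, bigger than everything.
data Ext : Set where
  fin : ℕ → Ext
  ∞   : Ext

_<E_ : Ext → Ext → Bool
fin a <E fin b = a <ᵇ b
fin a <E ∞     = true
∞     <E _     = false

isInf : Ext → Bool
isInf ∞       = true
isInf (fin _) = false

-- A tableau is a list of rows, row 0 (bottom) first; each row is listed
-- from column 0 rightwards.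
Tableau : Set
Tableau = List (List Ext)

insRow : Ext → List Ext → Maybe Ext × List Ext
insRow a [] = nothing , (a ∷ [])
insRow a (b ∷ r) with a <E b
... | true  = just b , (a ∷ r)
... | false with insRow a r
...   | mb , r' = mb , (b ∷ r')

insert : Tableau → Ext → Tableau
insert [] a = (a ∷ []) ∷ []
insert (r ∷ rs) a with insRow a r
... | nothing , r' = r' ∷ rs
... | just b  , r' = r' ∷ insert rs b

P : List Ext → Tableau
P w = foldl insert [] w

-- Young diagrams as lists of (positive, weakly decreasing) row lengths,
-- row 0 first.  Augmented Young diagram: (λ , (x , y)).
YD : Set
YD = List ℕ

AugYD : Set
AugYD = YD × (ℕ × ℕ)

isPos : ℕ → Bool
isPos zero    = false
isPos (suc _) = true

findInfRow : List Ext → Maybe ℕ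
findInfRow [] = nothing
findInfRow (∞ ∷ r) = just 0
findInfRow (fin _ ∷ r) with findInfRow r
... | just x  = just (suc x)
... | nothing = nothing

findInf : Tableau → Maybe (ℕ × ℕ)
findInf [] = nothing
findInf (r ∷ rs) with findInfRow r
... | just x  = just (x , 0)
... | nothing with findInf rs
...   | just (x , y) = just (x , suc y)
...   | nothing      = nothing

shapeWithoutInf : Tableau → YD
shapeWithoutInf T =
  filter (λ n → T? (isPos n))
    (map (λ r → length (filter (λ e → T? (not (isInf e))) r)) T)

-- sh* T  (nothing if T has no ∞ entry, which never happens below)
shStar : Tableau → Maybe AugYD
shStar T with findInf T
... | just p  = just (shapeWithoutInf T , p)
... | nothing = nothing

count> : ℕ → YD → ℕ
count> j ls = length (filter (λ n → T? (j <ᵇ n)) ls)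

conj : YD → YD
conj []      = []
conj (l ∷ ls) = map (λ j → count> j (l ∷ ls)) (upTo l)

transposeAug : Maybe AugYD → Maybe AugYD
transposeAug nothing               = nothing
transposeAug (just (ls , (x , y))) = just (conj ls , (y , x))

insertions : {A : Set} → A → List A → List (List A)
insertions a []       = (a ∷ []) ∷ []
insertions a (b ∷ bs) = (a ∷ b ∷ bs) ∷ map (b ∷_) (insertions a bs)

perms : {A : Set} → List A → List (List A)
perms []       = [] ∷ []
perms (a ∷ as) = concatMap (insertions a) (perms as)

word : ℕ → List ℕ → List Ext
word m σ = map fin (take m σ) ++ (∞ ∷ map fin (drop m σ))

-- Λ_m^{(t)} for the order pattern σ of (ξ₁,…,ξ_t)
augPlancherel : ℕ → List ℕ → Maybe AugYD
augPlancherel m σ = shStar (P (word m σ))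

-- Both sides are images of the uniformly distributed order pattern σ ∈ S_t.
-- Reversing σ is a bijection of S_t, and the word defining Λ_{m'} for the
-- reversed pattern is the reverse of the word defining Λ_m for σ.  So it is
-- enough that P(reverse w) = P(w)ᵀ for words w with distinct letters
-- (Schensted): then the largest letter ∞ sits in transposed boxes and the
-- remaining shapes are conjugate.  Schensted's theorem follows from the
-- commutation (x → T) ← y = x → (T ← y) of row and column insertion of
-- distinct letters, which identifies P(w), built by row insertions from the
-- left, with the tableau built by column insertions from the right; and column
-- insertion is row insertion conjugated by transposition.  The commutation is
-- proved by induction on T, peeling off its largest entry.

module Submission where

open import Defs
open import Data.Nat using (ℕ; _+_)
open import Data.List using (map; upTo)
open import Data.List.Relation.Binary.Permutation.Propositional using (_↭_)

open import Data.Nat as N using (zero; suc; _<_; _≤_; z≤n; s≤s; _<ᵇ_; _⊓_)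
import Data.Nat.Properties as NP
open import Data.Bool using (true; false; T; T?; not; if_then_else_)
open import Data.Bool.Properties using (T-≡)
open import Data.Maybe using (Maybe; just; nothing)
open import Data.Product using (_×_; _,_; proj₁; proj₂; Σ-syntax; swap)
open import Data.Product.Properties using (≡-dec)
import Data.Product as Product
open import Data.Sum using (_⊎_; inj₁; inj₂)
open import Data.Unit using (⊤; tt)
open import Data.Empty using (⊥-elim)
open import Data.List as L using (List; []; _∷_; _++_; _∷ʳ_)
open import Data.List.Relation.Unary.All as All using (All; []; _∷_)
open import Data.List.Relation.Unary.AllPairs using ([]; _∷_)
open import Data.List.Relation.Unary.Unique.Propositional using (Unique)
import Data.List.Relation.Unary.Unique.Propositional.Properties as UniqueP
import Data.List.Relation.Unary.Any.Properties as AnyP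
import Data.List.Relation.Unary.All.Properties as AllP
import Data.List.Properties as LP
import Data.List.Relation.Binary.Permutation.Propositional as Perm
import Data.List.Relation.Binary.Permutation.Propositional.Properties as PermP
open import Data.List.Membership.Propositional using (_∈_)
open import Data.List.Relation.Unary.Any using (here; there)
open import Function using (_∘_)
open import Function.Bundles using (module Equivalence)
open import Relation.Nullary using (¬_; Dec; yes; no)
open import Relation.Binary.PropositionalEquality
open import Relation.Binary using (tri<; tri≈; tri>)
open import Algebra.Properties.CommutativeSemigroup NP.+-commutativeSemigroup using (x∙yz≈y∙xz)

open Equivalence using (to; from)

<E-asym : ∀ e f → (e <E f) ≡ true → (f <E e) ≡ false
<E-asym (fin a) (fin b) h with b <ᵇ a in eq
... | false = refl
... | true = ⊥-elim (NP.<-asym (NP.<ᵇ⇒< a b (from T-≡ h)) (NP.<ᵇ⇒< b a (from T-≡ eq)))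
<E-asym (fin a) ∞ h = refl

<E-trans : ∀ e f g → (e <E f) ≡ true → (f <E g) ≡ true → (e <E g) ≡ true
<E-trans (fin a) (fin b) (fin c) h₁ h₂ =
  to T-≡ (NP.<⇒<ᵇ (NP.<-trans (NP.<ᵇ⇒< a b (from T-≡ h₁)) (NP.<ᵇ⇒< b c (from T-≡ h₂))))
<E-trans (fin a) (fin b) ∞ h₁ h₂ = refl

<E-connex : ∀ e f → e ≢ f → (e <E f) ≡ false → (f <E e) ≡ true
<E-connex (fin a) (fin b) e≢f h with NP.<-cmp a b
... | tri< a<b _ _ = ⊥-elim (subst T h (NP.<⇒<ᵇ a<b))
... | tri≈ _ refl _ = ⊥-elim (e≢f refl)
... | tri> _ _ b<a = to T-≡ (NP.<⇒<ᵇ b<a)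
<E-connex ∞ (fin b) e≢f h = refl
<E-connex ∞ ∞ e≢f h = ⊥-elim (e≢f refl)

Pos : Set
Pos = ℕ × ℕ

-- A filling lists its entries with their boxes (x , y), the last added entry
-- first; in a standard filling this is the largest entry.
Filling : Set
Filling = List (Ext × Pos)

δ : ℕ → ℕ → ℕ
δ zero    zero    = 1
δ zero    (suc b) = 0
δ (suc a) zero    = 0
δ (suc a) (suc b) = δ a b

δ-refl : ∀ a → δ a a ≡ 1
δ-refl zero    = refl
δ-refl (suc a) = δ-refl a

δ-≢ : ∀ {a b} → a ≢ b → δ a b ≡ 0
δ-≢ {zero}  {zero}  a≢b = ⊥-elim (a≢b refl)
δ-≢ {zero}  {suc b} a≢b = refl
δ-≢ {suc a} {zero}  a≢b = refl
δ-≢ {suc a} {suc b} a≢b = δ-≢ (a≢b ∘ cong suc)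

rowLen : ℕ → Filling → ℕ
rowLen i []                  = 0
rowLen i ((_ , (x , y)) ∷ A) = δ y i + rowLen i A

colLen : ℕ → Filling → ℕ
colLen j []                  = 0
colLen j ((_ , (x , y)) ∷ A) = δ x j + colLen j A

infixl 8 _ᵀ

_ᵀ : Filling → Filling
[] ᵀ                  = []
((n , (x , y)) ∷ A) ᵀ = (n , (y , x)) ∷ A ᵀ

ᵀ-involutive : ∀ A → (A ᵀ) ᵀ ≡ A
ᵀ-involutive []                  = refl
ᵀ-involutive ((n , (x , y)) ∷ A) = cong ((n , (x , y)) ∷_) (ᵀ-involutive A)

rowLen-ᵀ : ∀ i A → rowLen i (A ᵀ) ≡ colLen i A
rowLen-ᵀ i []                  = refl
rowLen-ᵀ i ((n , (x , y)) ∷ A) = cong (δ x i +_) (rowLen-ᵀ i A)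

colLen-ᵀ : ∀ i A → colLen i (A ᵀ) ≡ rowLen i A
colLen-ᵀ i []                  = refl
colLen-ᵀ i ((n , (x , y)) ∷ A) = cong (δ y i +_) (colLen-ᵀ i A)

All-ᵀ : ∀ {Q : Ext → Set} A → All (Q ∘ proj₁) A → All (Q ∘ proj₁) (A ᵀ)
All-ᵀ []                  []       = []
All-ᵀ ((n , (x , y)) ∷ A) (q ∷ qs) = q ∷ All-ᵀ A qs

rows cols : Filling → ℕ → ℕ
rows A i = rowLen i A
cols A j = colLen j A

OuterCorner : Filling → Pos → Set
OuterCorner A (x , y) = rowLen y A ≡ x × colLen x A ≡ y

AllBelow : Ext → Filling → Set
AllBelow n = All (λ q → (proj₁ q <E n) ≡ true)

Standard : Filling → Set
Standard []            = ⊤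
Standard ((n , p) ∷ A) = AllBelow n A × OuterCorner A p × Standard A

Fresh : Ext → Filling → Set
Fresh v = All (λ q → v ≢ proj₁ q)

AllBelow-trans : ∀ {u n} A → (n <E u) ≡ true → AllBelow n A → AllBelow u A
AllBelow-trans {u} {n} A n<u = All.map (λ {q} q<n → <E-trans (proj₁ q) n u q<n n<u)

OuterCorner-ᵀ : ∀ A x y → OuterCorner A (x , y) → OuterCorner (A ᵀ) (y , x)
OuterCorner-ᵀ A x y (r , c) = trans (rowLen-ᵀ x A) c , trans (colLen-ᵀ y A) r

Standard-ᵀ : ∀ A → Standard A → Standard (A ᵀ)
Standard-ᵀ []                  _           = tt
Standard-ᵀ ((n , (x , y)) ∷ A) (l , c , s) = All-ᵀ A l , OuterCorner-ᵀ A x y c , Standard-ᵀ A s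

corner-unique-row : ∀ A {a p} → OuterCorner A a → OuterCorner A p → proj₂ a ≡ proj₂ p → a ≡ p
corner-unique-row A {ax , ay} (r₁ , _) (r₂ , _) refl = cong (_, ay) (trans (sym r₁) r₂)

corner-unique-col : ∀ A {a p} → OuterCorner A a → OuterCorner A p → proj₁ a ≡ proj₁ p → a ≡ p
corner-unique-col A {ax , ay} (_ , c₁) (_ , c₂) refl = cong (ax ,_) (trans (sym c₁) c₂)

RowsFit : (ℕ → ℕ) → (ℕ → ℕ) → Set
RowsFit R C = ∀ x y → x < R y → y < C x

Conjugate : (ℕ → ℕ) → (ℕ → ℕ) → Set
Conjugate R C = RowsFit R C × RowsFit C R

RowsFit-addCorner : ∀ {R C px py} → R py ≡ px → C px ≡ py → RowsFit R C →
                    RowsFit (λ y → δ py y + R y) (λ x → δ px x + C x)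
RowsFit-addCorner {R} {C} {px} {py} hR hC fit x y h with y N.≟ py | x N.≟ px
... | yes refl | yes refl rewrite δ-refl px | hC = NP.n<1+n py
... | yes refl | no x≢px rewrite δ-refl y | δ-≢ (≢-sym x≢px) =
  fit x y (subst (x <_) (sym hR) (NP.≤∧≢⇒< (NP.≤-pred (subst (x <_) (cong suc hR) h)) x≢px))
... | no y≢py | yes refl rewrite δ-refl x | δ-≢ (≢-sym y≢py) = NP.m<n⇒m<1+n (fit x y h)
... | no y≢py | no x≢px rewrite δ-≢ (≢-sym y≢py) | δ-≢ (≢-sym x≢px) = fit x y h

module _ {R C : ℕ → ℕ} where

  Conjugate-addCorner : ∀ {px py} → R py ≡ px → C px ≡ py → Conjugate R C →
                        Conjugate (λ y → δ py y + R y) (λ x → δ px x + C x)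
  Conjugate-addCorner hR hC (fit , fit′) = RowsFit-addCorner hR hC fit , RowsFit-addCorner hC hR fit′

  fit-rowEnd : RowsFit C R → ∀ y → C (R y) ≤ y
  fit-rowEnd fit′ y = NP.≮⇒≥ (λ h → NP.<-irrefl refl (fit′ y (R y) h))

  conjugate-antitone : Conjugate R C → ∀ {y′ y} → y′ ≤ y → R y ≤ R y′
  conjugate-antitone (fit , fit′) {y′} {y} y′≤y =
    bound (R y) (λ x h → fit′ y′ x (NP.≤-<-trans y′≤y (fit x y h)))
    where
    bound : ∀ a {b} → (∀ x → x < a → x < b) → a ≤ b
    bound zero    h = z≤n
    bound (suc a) h = h a (NP.n<1+n a)

  module _ (dual : Conjugate R C) where

    col0-empty⇒row0-empty : C 0 ≡ 0 → R 0 ≡ 0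
    col0-empty⇒row0-empty e =
      NP.n≤0⇒n≡0 (NP.≮⇒≥ (λ h → NP.<-irrefl refl (subst (0 <_) e (proj₁ dual 0 0 h))))

    col0-empty⇒row1-empty : C 0 ≡ 0 → R 1 ≡ 0
    col0-empty⇒row1-empty e =
      NP.n≤0⇒n≡0 (subst (R 1 ≤_) (col0-empty⇒row0-empty e) (conjugate-antitone dual z≤n))

    col-past-row0-empty : C (suc (R 0)) ≡ 0
    col-past-row0-empty =
      NP.n≤0⇒n≡0 (NP.≮⇒≥ (λ h → NP.<-asym (proj₂ dual 0 (suc (R 0)) h) (NP.n<1+n _)))

    module _ {px py} (hR : R py ≡ px) (hC : C px ≡ py) where

      private
        k = R (suc py)
        k≤px : k ≤ px
        k≤px = subst (k ≤_) hR (conjugate-antitone dual (NP.n≤1+n py))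

      -- Adding the corner (px , py) makes the end of row py + 1 a corner.
      colLen-nextRowEnd : δ px k + C k ≡ suc py
      colLen-nextRowEnd with k N.≟ px
      ... | yes e rewrite e | δ-refl px | hC = refl
      ... | no k≢px rewrite δ-≢ (≢-sym k≢px) =
        NP.≤-antisym (fit-rowEnd (proj₂ dual) (suc py))
                     (proj₁ dual k py (subst (k <_) (sym hR) (NP.≤∧≢⇒< k≤px k≢px)))

      colLen-pastNextRowEnd : C k ≡ suc py → δ px (suc k) + C (suc k) ≡ suc py
      colLen-pastNextRowEnd hk with px N.≟ suc k
      ... | yes e rewrite sym e | δ-refl px = cong suc hC
      ... | no px≢ rewrite δ-≢ px≢ = NP.≤-antisym upper lower
        where
        k≢px : k ≢ px
        k≢px e = NP.<-irrefl refl (subst (py <_) (trans (cong C e) hC) (subst (py <_) (sym hk) (NP.n<1+n py)))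
        lower : suc py ≤ C (suc k)
        lower = proj₁ dual (suc k) py
                  (subst (suc k <_) (sym hR) (NP.≤∧≢⇒< (NP.≤∧≢⇒< k≤px k≢px) (≢-sym px≢)))
        upper : C (suc k) ≤ suc py
        upper = NP.≮⇒≥ (λ h → NP.<-asym (proj₂ dual (suc py) (suc k) h) (NP.n<1+n k))

standard⇒conjugate : ∀ A → Standard A → Conjugate (rows A) (cols A)
standard⇒conjugate []            _               = (λ _ _ ()) , (λ _ _ ())
standard⇒conjugate ((n , p) ∷ A) (_ , (r , c) , s) = Conjugate-addCorner r c (standard⇒conjugate A s)

row0End-outerCorner : ∀ A → Standard A → OuterCorner A (rowLen 0 A , 0)
row0End-outerCorner A s = refl , NP.n≤0⇒n≡0 (fit-rowEnd (proj₂ (standard⇒conjugate A s)) 0)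

-- Row insertion

AddsBox : Filling → Filling → Pos → Set
AddsBox A A₁ a = (∀ i → rowLen i A₁ ≡ δ (proj₂ a) i + rowLen i A)
               × (∀ j → colLen j A₁ ≡ δ (proj₁ a) j + colLen j A)

ValidInsertion : Filling → Filling × Pos → Set
ValidInsertion A r = OuterCorner A (proj₂ r) × Standard (proj₁ r) × AddsBox A (proj₁ r) (proj₂ r)

AddsBox-∷ : ∀ {A A₁ a} n p → AddsBox A A₁ a → AddsBox ((n , p) ∷ A) ((n , p) ∷ A₁) a
AddsBox-∷ {A} {a = ax , ay} n (px , py) (r , c) =
  (λ i → trans (cong (δ py i +_) (r i)) (x∙yz≈y∙xz (δ py i) (δ ay i) (rowLen i A))) ,
  (λ j → trans (cong (δ px j +_) (c j)) (x∙yz≈y∙xz (δ px j) (δ ax j) (colLen j A)))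

OuterCorner-addBox : ∀ A A₁ {u v} → OuterCorner A u → OuterCorner A v → u ≢ v →
                     AddsBox A A₁ v → OuterCorner A₁ u
OuterCorner-addBox A A₁ {ux , uy} {vx , vy} cu cv u≢v (r , c) =
  trans (r uy) (trans (cong (_+ rowLen uy A) (δ-≢ (u≢v ∘ sym ∘ corner-unique-row A cv cu))) (proj₁ cu)) ,
  trans (c ux) (trans (cong (_+ colLen ux A) (δ-≢ (u≢v ∘ sym ∘ corner-unique-col A cv cu))) (proj₂ cu))

appendRow0 : Ext → Filling → Filling × Pos
appendRow0 v A = (v , (rowLen 0 A , 0)) ∷ A , (rowLen 0 A , 0)

nextRowEnd : ℕ → Filling → Pos
nextRowEnd py A = rowLen (suc py) A , suc py

-- The largest entry n, sitting in box p, is bumped to the end of the next row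
-- exactly when the insertion into the smaller entries stops in the row of p.
rowSettle : Ext → Pos → Filling → Filling × Pos → Filling × Pos
rowSettle n (px , py) A (A₁ , a) with proj₂ a N.≟ py
... | yes _ = (n , nextRowEnd py A) ∷ A₁ , nextRowEnd py A
... | no _  = (n , (px , py)) ∷ A₁ , a

rowInsert : Ext → Filling → Filling × Pos
rowInsert v []            = appendRow0 v []
rowInsert v ((n , p) ∷ A) with n <E v
... | true  = appendRow0 v ((n , p) ∷ A)
... | false = rowSettle n p A (rowInsert v A)

infixl 6 _←ʳ_

_←ʳ_ : Filling → Ext → Filling
A ←ʳ v = proj₁ (rowInsert v A)

rowSettle-bump : ∀ {n px py A A₁ a} → proj₂ a ≡ py →
  rowSettle n (px , py) A (A₁ , a) ≡ ((n , nextRowEnd py A) ∷ A₁ , nextRowEnd py A)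
rowSettle-bump {py = py} {a = a} e with proj₂ a N.≟ py
... | yes _  = refl
... | no ne = ⊥-elim (ne e)

rowSettle-stay : ∀ {n px py A A₁ a} → proj₂ a ≢ py →
  rowSettle n (px , py) A (A₁ , a) ≡ ((n , (px , py)) ∷ A₁ , a)
rowSettle-stay {py = py} {a = a} ne with proj₂ a N.≟ py
... | yes e = ⊥-elim (ne e)
... | no _  = refl

rowInsert-∷ : ∀ {v n} p A → (n <E v) ≡ false →
              rowInsert v ((n , p) ∷ A) ≡ rowSettle n p A (rowInsert v A)
rowInsert-∷ p A n≮v rewrite n≮v = refl

rowInsert-top : ∀ v A → AllBelow v A → rowInsert v A ≡ appendRow0 v A
rowInsert-top v []            _         = refl
rowInsert-top v ((n , p) ∷ A) (n<v ∷ _) rewrite n<v = refl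

entries : Filling → List Ext
entries = L.map proj₁

rowSettle-entries : ∀ n p A r → entries (proj₁ (rowSettle n p A r)) ≡ n ∷ entries (proj₁ r)
rowSettle-entries n (px , py) A (A₁ , a) with proj₂ a N.≟ py
... | yes _ = refl
... | no _  = refl

rowInsert-entries : ∀ v A → entries (A ←ʳ v) ↭ v ∷ entries A
rowInsert-entries v []            = Perm.↭-refl
rowInsert-entries v ((n , p) ∷ A) with n <E v
... | true  = Perm.↭-refl
... | false = Perm.↭-trans (Perm.↭-reflexive (rowSettle-entries n p A (rowInsert v A)))
                (Perm.↭-trans (Perm.prep n (rowInsert-entries v A)) (Perm.swap n v Perm.↭-refl))

rowInsert-All : ∀ {Q : Ext → Set} v A → All (Q ∘ proj₁) A → Q v → All (Q ∘ proj₁) (A ←ʳ v)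
rowInsert-All v A qs q =
  AllP.map⁻ (PermP.All-resp-↭ (Perm.↭-sym (rowInsert-entries v A)) (q ∷ AllP.map⁺ qs))

appendRow0-valid : ∀ v A → Standard A → AllBelow v A → ValidInsertion A (appendRow0 v A)
appendRow0-valid v A s l = c₀ , (l , c₀ , s) , (λ _ → refl) , (λ _ → refl)
  where c₀ = row0End-outerCorner A s

nextRowEnd-outerCorner : ∀ n {px py} A → Standard A → OuterCorner A (px , py) →
                      OuterCorner ((n , (px , py)) ∷ A) (nextRowEnd py A)
nextRowEnd-outerCorner n {px} {py} A s (r , c) =
  cong (_+ rowLen (suc py) A) (δ-≢ (NP.<⇒≢ (NP.n<1+n py))) ,
  colLen-nextRowEnd (standard⇒conjugate A s) r c

OuterCorner-sameShape : ∀ A A₁ (b : Ext × Pos) {c} → AddsBox A A₁ (proj₂ b) →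
                        OuterCorner (b ∷ A) c → OuterCorner A₁ c
OuterCorner-sameShape A A₁ b (r , k) (cr , cc) = trans (r _) cr , trans (k _) cc

module _ {n px py A} (s : Standard ((n , (px , py)) ∷ A)) {A₁ a}
         (valid : ValidInsertion A (A₁ , a)) (l₁ : AllBelow n A₁) where

  private
    p = (px , py)
    cp = proj₁ (proj₂ s)
    ca = proj₁ valid
    adds = proj₂ (proj₂ valid)

  rowSettle-stay-valid : proj₂ a ≢ py → ValidInsertion ((n , p) ∷ A) ((n , p) ∷ A₁ , a)
  rowSettle-stay-valid a≢ =
    OuterCorner-addBox A ((n , p) ∷ A) ca cp (a≢ ∘ cong proj₂) ((λ _ → refl) , (λ _ → refl)) ,
    (l₁ , OuterCorner-addBox A A₁ cp ca (a≢ ∘ cong proj₂ ∘ sym) adds , proj₁ (proj₂ valid)) ,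
    AddsBox-∷ {A} {A₁} {a} n p adds

  rowSettle-bump-valid : proj₂ a ≡ py →
    ValidInsertion ((n , p) ∷ A) ((n , nextRowEnd py A) ∷ A₁ , nextRowEnd py A)
  rowSettle-bump-valid a≡ =
    cq , (l₁ , OuterCorner-sameShape A A₁ (n , p) adds′ cq , proj₁ (proj₂ valid)) ,
    (λ i → cong (δ (suc py) i +_) (proj₁ adds′ i)) , (λ j → cong (δ (proj₁ q) j +_) (proj₂ adds′ j))
    where
    q = nextRowEnd py A
    adds′ : AddsBox A A₁ p
    adds′ = subst (AddsBox A A₁) (corner-unique-row A ca cp a≡) adds
    cq : OuterCorner ((n , p) ∷ A) q
    cq = nextRowEnd-outerCorner n A (proj₂ (proj₂ s)) cp

  rowSettle-valid : ValidInsertion ((n , p) ∷ A) (rowSettle n p A (A₁ , a))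
  rowSettle-valid with proj₂ a N.≟ py
  ... | yes a≡ = rowSettle-bump-valid a≡
  ... | no a≢  = rowSettle-stay-valid a≢

rowInsert-valid : ∀ v A → Standard A → Fresh v A → ValidInsertion A (rowInsert v A)
rowInsert-valid v []            _ _ = appendRow0-valid v [] tt []
rowInsert-valid v ((n , p) ∷ A) s (v≢n ∷ f) with n <E v in n<v
... | true  = appendRow0-valid v _ s (n<v ∷ AllBelow-trans A n<v (proj₁ s))
... | false = rowSettle-valid s (rowInsert-valid v A (proj₂ (proj₂ s)) f)
                (rowInsert-All v A (proj₁ s) (<E-connex n v (≢-sym v≢n) n<v))

-- Column insertion

mirror : Filling × Pos → Filling × Pos
mirror = Product.map _ᵀ swap

mirror-involutive : ∀ r → mirror (mirror r) ≡ r
mirror-involutive (A , a) = cong (_, a) (ᵀ-involutive A)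

colInsert : Ext → Filling → Filling × Pos
colInsert v A = mirror (rowInsert v (A ᵀ))

infixr 6 _→ᶜ_

_→ᶜ_ : Ext → Filling → Filling
v →ᶜ A = proj₁ (colInsert v A)

nextColEnd : ℕ → Filling → Pos
nextColEnd px A = suc px , colLen (suc px) A

colSettle : Ext → Pos → Filling → Filling × Pos → Filling × Pos
colSettle n (px , py) A (B₁ , b) with proj₁ b N.≟ px
... | yes _ = (n , nextColEnd px A) ∷ B₁ , nextColEnd px A
... | no _  = (n , (px , py)) ∷ B₁ , b

colSettle-bump : ∀ {n px py A B₁ b} → proj₁ b ≡ px →
  colSettle n (px , py) A (B₁ , b) ≡ ((n , nextColEnd px A) ∷ B₁ , nextColEnd px A)
colSettle-bump {px = px} {b = b} e with proj₁ b N.≟ px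
... | yes _  = refl
... | no ne = ⊥-elim (ne e)

colSettle-stay : ∀ {n px py A B₁ b} → proj₁ b ≢ px →
  colSettle n (px , py) A (B₁ , b) ≡ ((n , (px , py)) ∷ B₁ , b)
colSettle-stay {px = px} {b = b} ne with proj₁ b N.≟ px
... | yes e = ⊥-elim (ne e)
... | no _  = refl

colInsert-∷ : ∀ {v n} p A → (n <E v) ≡ false →
              colInsert v ((n , p) ∷ A) ≡ colSettle n p A (colInsert v A)
colInsert-∷ {v} {n} (px , py) A n≮v rewrite n≮v with rowInsert v (A ᵀ)
... | (A₁ , (ax , ay)) with ay N.≟ px
... | yes _ = cong (λ c → (n , (suc px , c)) ∷ A₁ ᵀ , (suc px , c)) (rowLen-ᵀ (suc px) A)
... | no _  = refl

colInsert-top : ∀ v A → AllBelow v A → colInsert v A ≡ ((v , (0 , colLen 0 A)) ∷ A , (0 , colLen 0 A))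
colInsert-top v A l rewrite rowInsert-top v (A ᵀ) (All-ᵀ A l) | ᵀ-involutive A | rowLen-ᵀ 0 A = refl

colInsert-All : ∀ {Q : Ext → Set} v A → All (Q ∘ proj₁) A → Q v → All (Q ∘ proj₁) (v →ᶜ A)
colInsert-All v A qs q = All-ᵀ _ (rowInsert-All v (A ᵀ) (All-ᵀ A qs) q)

ValidInsertion-ᵀ : ∀ A r → ValidInsertion (A ᵀ) r → ValidInsertion A (mirror r)
ValidInsertion-ᵀ A (A₁ , (ax , ay)) (c , s , r , k) =
  subst (λ B → OuterCorner B (ay , ax)) (ᵀ-involutive A) (OuterCorner-ᵀ (A ᵀ) ax ay c) ,
  Standard-ᵀ A₁ s ,
  (λ i → trans (rowLen-ᵀ i A₁) (trans (k i) (cong (δ ax i +_) (colLen-ᵀ i A)))) ,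
  (λ j → trans (colLen-ᵀ j A₁) (trans (r j) (cong (δ ay j +_) (rowLen-ᵀ j A))))

colInsert-valid : ∀ v A → Standard A → Fresh v A → ValidInsertion A (colInsert v A)
colInsert-valid v A s f =
  ValidInsertion-ᵀ A (rowInsert v (A ᵀ)) (rowInsert-valid v (A ᵀ) (Standard-ᵀ A s) (All-ᵀ A f))

-- Commutation of row and column insertion

Adjacent : Pos → Pos → Set
Adjacent (ax , ay) c = c ≡ (suc ax , ay) ⊎ c ≡ (ax , suc ay)

-- For the four insertions of Commute below, a and b are the boxes created by
-- inserting into A, b′ and a′ the boxes created by the second insertions.
NewBoxes : Pos → Pos → Pos → Pos → Set
NewBoxes a b b′ a′ = (a ≢ b × b′ ≡ b × a′ ≡ a) ⊎ (a ≡ b × b′ ≡ a′ × Adjacent a b′)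

CommuteAt : (r₁ r₂ r₃ r₄ : Filling × Pos) → Set
CommuteAt r₁ r₂ r₃ r₄ =
  proj₁ r₂ ≡ proj₁ r₄ × NewBoxes (proj₂ r₁) (proj₂ r₃) (proj₂ r₂) (proj₂ r₄)

InsertionSquare : Filling → Ext → Ext → (r₁ r₂ r₃ r₄ : Filling × Pos) → Set
InsertionSquare A x y r₁ r₂ r₃ r₄ =
  rowInsert y A ≡ r₁ × colInsert x (proj₁ r₁) ≡ r₂ ×
  colInsert x A ≡ r₃ × rowInsert y (proj₁ r₃) ≡ r₄

Commute : Filling → Ext → Ext → Set
Commute A x y = CommuteAt (rowInsert y A) (colInsert x (proj₁ (rowInsert y A)))
                          (colInsert x A) (rowInsert y (proj₁ (colInsert x A)))

Commute-via : ∀ A x y {r₁ r₂ r₃ r₄} → InsertionSquare A x y r₁ r₂ r₃ r₄ →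
              CommuteAt r₁ r₂ r₃ r₄ → Commute A x y
Commute-via A x y (refl , refl , refl , refl) c = c

rowInsert-ᵀ : ∀ v A → rowInsert v (A ᵀ) ≡ mirror (colInsert v A)
rowInsert-ᵀ v A = sym (mirror-involutive (rowInsert v (A ᵀ)))

colInsert-ᵀ : ∀ v A → colInsert v (A ᵀ) ≡ mirror (rowInsert v A)
colInsert-ᵀ v A = cong (λ B → mirror (rowInsert v B)) (ᵀ-involutive A)

InsertionSquare-ᵀ : ∀ A x y → InsertionSquare (A ᵀ) y x
  (mirror (colInsert x A)) (mirror (rowInsert y (proj₁ (colInsert x A))))
  (mirror (rowInsert y A)) (mirror (colInsert x (proj₁ (rowInsert y A))))
InsertionSquare-ᵀ A x y =
  rowInsert-ᵀ x A , colInsert-ᵀ y (proj₁ (colInsert x A)) ,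
  colInsert-ᵀ y A , rowInsert-ᵀ x (proj₁ (rowInsert y A))

Adjacent-swap : ∀ b c → Adjacent (swap b) (swap c) → Adjacent b c
Adjacent-swap b c (inj₁ e) = inj₂ (cong swap e)
Adjacent-swap b c (inj₂ e) = inj₁ (cong swap e)

NewBoxes-swap : ∀ {a b b′ a′} → NewBoxes (swap b) (swap a) (swap a′) (swap b′) → NewBoxes a b b′ a′
NewBoxes-swap (inj₁ (ne , e₁ , e₂)) = inj₁ (ne ∘ cong swap ∘ sym , cong swap e₂ , cong swap e₁)
NewBoxes-swap {a} {b} {b′} {a′} (inj₂ (e₁ , e₂ , adj)) =
  inj₂ (a≡b , cong swap (sym e₂) ,
        subst₂ Adjacent (sym a≡b) (cong swap e₂) (Adjacent-swap b a′ adj))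
  where
  a≡b : a ≡ b
  a≡b = cong swap (sym e₁)

Commute-at : ∀ A x y {r₁ r₂ r₃ r₄} → InsertionSquare A x y r₁ r₂ r₃ r₄ →
             Commute A x y → CommuteAt r₁ r₂ r₃ r₄
Commute-at A x y (refl , refl , refl , refl) c = c

ᵀ-injective : ∀ {A B} → A ᵀ ≡ B ᵀ → A ≡ B
ᵀ-injective {A} {B} e = trans (sym (ᵀ-involutive A)) (trans (cong _ᵀ e) (ᵀ-involutive B))

Commute-ᵀ : ∀ A x y → Commute (A ᵀ) y x → Commute A x y
Commute-ᵀ A x y c with Commute-at (A ᵀ) y x (InsertionSquare-ᵀ A x y) c
... | eq , boxes = sym (ᵀ-injective eq) , NewBoxes-swap boxes

Commute-ᵀ⁻¹ : ∀ A x y → Commute A x y → Commute (A ᵀ) y x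
Commute-ᵀ⁻¹ A x y c = Commute-ᵀ (A ᵀ) y x (subst (λ B → Commute B x y) (sym (ᵀ-involutive A)) c)

module _ {A : Filling} (s : Standard A) where

  private
    dual = standard⇒conjugate A s
    r₀ = rowLen 0 A
    c₀ = colLen 0 A

  commute-bothTop : ∀ {x y} → AllBelow y A → (y <E x) ≡ true → Commute A x y
  commute-bothTop {x} {y} l y<x =
    Commute-via A x y
      (rowInsert-top y A l , colInsert-top x _ (y<x ∷ lx) , colInsert-top x A lx ,
       trans (rowInsert-∷ (0 , c₀) A (<E-asym y x y<x)) (cong (rowSettle x (0 , c₀) A) (rowInsert-top y A l)))
      square
    where
    lx : AllBelow x A
    lx = AllBelow-trans A y<x l
    A₁ = (y , (r₀ , 0)) ∷ A
    square : CommuteAt (appendRow0 y A) ((x , (0 , colLen 0 A₁)) ∷ A₁ , (0 , colLen 0 A₁))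
                       ((x , (0 , c₀)) ∷ A , (0 , c₀)) (rowSettle x (0 , c₀) A (appendRow0 y A))
    square with 0 N.≟ c₀
    ... | yes e rewrite sym e | col0-empty⇒row0-empty dual (sym e) | col0-empty⇒row1-empty dual (sym e) =
      refl , inj₂ (refl , refl , inj₂ refl)
    ... | no ne rewrite δ-≢ (ne ∘ sym ∘ col0-empty⇒row0-empty (swap dual)) =
      refl , inj₁ (ne ∘ cong proj₂ , refl , refl)

  commute-rowTop : ∀ {x y} → Fresh x A → AllBelow y A → (y <E x) ≡ false → x ≢ y → Commute A x y
  commute-rowTop {x} {y} fx l y≮x x≢y with colInsert x A in e₃
  ... | (B₁ , (bx , by)) =
    Commute-via A x y
      (rowInsert-top y A l , trans (colInsert-∷ (r₀ , 0) A y≮x) (cong (colSettle y (r₀ , 0) A) e₃) ,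
       e₃ , rowInsert-top y B₁ l₁)
      square
    where
    valid : ValidInsertion A (B₁ , (bx , by))
    valid = subst (ValidInsertion A) e₃ (colInsert-valid x A s fx)
    l₁ : AllBelow y B₁
    l₁ = subst (AllBelow y ∘ proj₁) e₃ (colInsert-All x A l (<E-connex y x (≢-sym x≢y) y≮x))
    by≡0 : bx ≡ r₀ → by ≡ 0
    by≡0 e = NP.n≤0⇒n≡0 (subst (_≤ 0) (trans (cong (λ z → colLen z A) (sym e)) (proj₂ (proj₁ valid)))
                                      (fit-rowEnd (proj₂ dual) 0))
    by≢0 : bx ≢ r₀ → by ≢ 0
    by≢0 ne e = ne (sym (subst (λ z → rowLen z A ≡ bx) e (proj₁ (proj₁ valid))))
    square : CommuteAt (appendRow0 y A) (colSettle y (r₀ , 0) A (B₁ , (bx , by)))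
                       (B₁ , (bx , by)) (appendRow0 y B₁)
    square with bx N.≟ r₀
    ... | yes e rewrite proj₁ (proj₂ (proj₂ valid)) 0 | by≡0 e | col-past-row0-empty dual | e =
      refl , inj₂ (refl , refl , inj₁ refl)
    ... | no ne rewrite proj₁ (proj₂ (proj₂ valid)) 0 | δ-≢ (by≢0 ne) =
      refl , inj₁ (ne ∘ sym ∘ cong proj₁ , refl , refl)

corners-nonadjacent : ∀ A {a p} → OuterCorner A a → OuterCorner A p → ¬ Adjacent a p
corners-nonadjacent A ca cp (inj₁ refl) = NP.1+n≢n (sym (cong proj₁ (corner-unique-row A ca cp refl)))
corners-nonadjacent A ca cp (inj₂ refl) = NP.1+n≢n (sym (cong proj₂ (corner-unique-col A ca cp refl)))

-- Given how the four insertions into A end, the largest entry n keeps its box p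
-- or is bumped by exactly those insertions that end in its row (resp. column).
module _ {n : Ext} {px py : ℕ} {A : Filling} {x y : Ext}
         (s : Standard ((n , (px , py)) ∷ A)) (fx : Fresh x A) (fy : Fresh y A) (x≢y : x ≢ y)
         (n≮x : (n <E x) ≡ false) (n≮y : (n <E y) ≡ false) where

  private
    p = (px , py)
    cp = proj₁ (proj₂ s)
    sA = proj₂ (proj₂ s)
    dual = standard⇒conjugate A sA
    k = rowLen (suc py) A
    q = nextRowEnd py A

    k≤px : k ≤ px
    k≤px = subst (k ≤_) (proj₁ cp) (conjugate-antitone dual (NP.n≤1+n py))

    rowStep : ∀ {C r} c → rowInsert y C ≡ r → rowInsert y ((n , c) ∷ C) ≡ rowSettle n c C r
    rowStep {C} c e = trans (rowInsert-∷ c C n≮y) (cong (rowSettle n c C) e)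

    colStep : ∀ {C r} c → colInsert x C ≡ r → colInsert x ((n , c) ∷ C) ≡ colSettle n c C r
    colStep {C} c e = trans (colInsert-∷ c C n≮x) (cong (colSettle n c C) e)

    valid₁ : ∀ {r} → rowInsert y A ≡ r → ValidInsertion A r
    valid₁ refl = rowInsert-valid y A sA fy

    valid₃ : ∀ {r} → colInsert x A ≡ r → ValidInsertion A r
    valid₃ refl = colInsert-valid x A sA fx

    valid₂ : ∀ {r₁ r₂} → rowInsert y A ≡ r₁ → colInsert x (proj₁ r₁) ≡ r₂ →
             ValidInsertion (proj₁ r₁) r₂
    valid₂ refl refl =
      colInsert-valid x _ (proj₁ (proj₂ (valid₁ refl))) (rowInsert-All {x ≢_} y A fx x≢y)

    valid₄ : ∀ {r₃ r₄} → colInsert x A ≡ r₃ → rowInsert y (proj₁ r₃) ≡ r₄ →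
             ValidInsertion (proj₁ r₃) r₄
    valid₄ refl refl =
      rowInsert-valid y _ (proj₁ (proj₂ (valid₃ refl))) (colInsert-All {y ≢_} x A fy (≢-sym x≢y))

    rowLen-nextRow : ∀ B {b} → AddsBox A B b → proj₂ b ≢ suc py → rowLen (suc py) B ≡ k
    rowLen-nextRow B adds ne = trans (proj₁ adds (suc py)) (cong (_+ k) (δ-≢ ne))

  commute-stay : ∀ {A₁ a A₂ b′ B₁ b B₂ a′} →
    InsertionSquare A x y (A₁ , a) (A₂ , b′) (B₁ , b) (B₂ , a′) →
    CommuteAt (A₁ , a) (A₂ , b′) (B₁ , b) (B₂ , a′) →
    a ≢ p → b ≢ p → Commute ((n , p) ∷ A) x y
  commute-stay {A₁} {a} {b′ = b′} {B₁} {b} {a′ = a′}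
               (e₁ , e₂ , e₃ , e₄) (eq , boxes) a≢p b≢p =
    Commute-via ((n , p) ∷ A) x y
      (trans (rowStep p e₁) (rowSettle-stay (a≢p ∘ corner-unique-row A ca cp)) ,
       trans (colStep p e₂) (colSettle-stay (b′-col boxes)) ,
       trans (colStep p e₃) (colSettle-stay (b≢p ∘ corner-unique-col A cb cp)) ,
       trans (rowStep p e₄) (rowSettle-stay (a′-row boxes)))
      (cong ((n , p) ∷_) eq , boxes)
    where
    ca = proj₁ (valid₁ e₁)
    cb = proj₁ (valid₃ e₃)
    cp₁ : OuterCorner A₁ p
    cp₁ = OuterCorner-addBox A A₁ cp ca (a≢p ∘ sym) (proj₂ (proj₂ (valid₁ e₁)))
    cp₃ : OuterCorner B₁ p
    cp₃ = OuterCorner-addBox A B₁ cp cb (b≢p ∘ sym) (proj₂ (proj₂ (valid₃ e₃)))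
    -- b′ is b or next to a, and a′ is a or b′; none of them can share the column (row) of p.
    b′-col : NewBoxes a b b′ a′ → proj₁ b′ ≢ px
    b′-col (inj₁ (_ , b′≡b , _)) e =
      b≢p (corner-unique-col A cb cp (trans (cong proj₁ (sym b′≡b)) e))
    b′-col (inj₂ (_ , _ , adj))  e =
      corners-nonadjacent A ca cp
        (subst (Adjacent a) (corner-unique-col A₁ (proj₁ (valid₂ e₁ e₂)) cp₁ e) adj)
    a′-row : NewBoxes a b b′ a′ → proj₂ a′ ≢ py
    a′-row (inj₁ (_ , _ , a′≡a))    e =
      a≢p (corner-unique-row A ca cp (trans (cong proj₂ (sym a′≡a)) e))
    a′-row (inj₂ (_ , b′≡a′ , adj)) e =
      corners-nonadjacent A ca cp
        (subst (Adjacent a) (trans b′≡a′ (corner-unique-row B₁ (proj₁ (valid₄ e₃ e₄)) cp₃ e)) adj)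

  commute-rowBump : ∀ {A₁ a A₂ b′ B₁ bx by B₂ a′} →
    InsertionSquare A x y (A₁ , a) (A₂ , b′) (B₁ , (bx , by)) (B₂ , a′) →
    CommuteAt (A₁ , a) (A₂ , b′) (B₁ , (bx , by)) (B₂ , a′) →
    a ≡ p → (bx , by) ≢ p → Commute ((n , p) ∷ A) x y
  commute-rowBump _ (_ , inj₂ (a≡b , _)) refl b≢p = ⊥-elim (b≢p (sym a≡b))
  commute-rowBump {A₁} {B₁ = B₁} {bx} {by} {B₂}
                  (e₁ , e₂ , e₃ , e₄) (eq , inj₁ (_ , refl , refl)) refl b≢p =
    settle (bx N.≟ k)
    where
    adds₁ = proj₂ (proj₂ (valid₁ e₁))
    adds₃ = proj₂ (proj₂ (valid₃ e₃))
    cb = proj₁ (valid₃ e₃)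
    bx≢px : bx ≢ px
    bx≢px = b≢p ∘ corner-unique-col A cb cp
    squareFrom : ∀ {r₂} → colInsert x ((n , q) ∷ A₁) ≡ r₂ →
      CommuteAt ((n , q) ∷ A₁ , q) r₂ ((n , p) ∷ B₁ , (bx , by))
                ((n , nextRowEnd py B₁) ∷ B₂ , nextRowEnd py B₁) →
      Commute ((n , p) ∷ A) x y
    squareFrom e₂′ = Commute-via ((n , p) ∷ A) x y
      (trans (rowStep p e₁) (rowSettle-bump refl) , e₂′ ,
       trans (colStep p e₃) (colSettle-stay bx≢px) , trans (rowStep p e₄) (rowSettle-bump refl))
    settle : Dec (bx ≡ k) → Commute ((n , p) ∷ A) x y
    settle (yes bx≡k) =
      squareFrom (trans (colStep q e₂) (colSettle-bump bx≡k))
        (cong₂ (λ c B → (n , c) ∷ B) ends eq , inj₂ (sym b≡q , ends , inj₁ (cong (suc k ,_) col)))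
      where
      b≡q : (bx , by) ≡ q
      b≡q = corner-unique-col A₁ (OuterCorner-addBox A A₁ cb cp b≢p adds₁)
                              (OuterCorner-sameShape A A₁ (n , p) adds₁ (nextRowEnd-outerCorner n A sA cp)) bx≡k
      col : colLen (suc k) A₁ ≡ suc py
      col = trans (proj₂ adds₁ (suc k))
                  (colLen-pastNextRowEnd dual (proj₁ cp) (proj₂ cp) (subst (OuterCorner A) b≡q cb .proj₂))
      row : rowLen (suc py) B₁ ≡ suc k
      row = begin
        rowLen (suc py) B₁       ≡⟨ proj₁ adds₃ (suc py) ⟩
        δ by (suc py) + k        ≡⟨ cong (λ c → δ (proj₂ c) (suc py) + k) b≡q ⟩
        δ (suc py) (suc py) + k  ≡⟨ cong (_+ k) (δ-refl (suc py)) ⟩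
        suc k                    ∎
        where open ≡-Reasoning
      ends : nextColEnd k A₁ ≡ nextRowEnd py B₁
      ends = cong₂ _,_ (sym row) col
    settle (no bx≢k) =
      squareFrom (trans (colStep q e₂) (colSettle-stay bx≢k))
        (cong₂ (λ c B → (n , c) ∷ B) (cong (_, suc py) (sym row)) eq ,
         inj₁ (bx≢k ∘ cong proj₁ ∘ sym , refl , cong (_, suc py) row))
      where
      row : rowLen (suc py) B₁ ≡ k
      row = rowLen-nextRow B₁ {bx , by} adds₃
              (λ e → bx≢k (trans (sym (proj₁ cb)) (cong (λ z → rowLen z A) e)))

  commute-bothBump : ∀ {A₁ a A₂ b′ B₁ b B₂ a′} →
    InsertionSquare A x y (A₁ , a) (A₂ , b′) (B₁ , b) (B₂ , a′) →
    CommuteAt (A₁ , a) (A₂ , b′) (B₁ , b) (B₂ , a′) →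
    a ≡ p → b ≡ p → b′ ≡ (suc px , py) → Commute ((n , p) ∷ A) x y
  commute-bothBump _ (_ , inj₁ (a≢b , _)) refl refl _ = ⊥-elim (a≢b refl)
  commute-bothBump {B₁ = B₁} (e₁ , e₂ , e₃ , e₄) (eq , inj₂ (_ , refl , _)) refl refl refl =
    Commute-via ((n , p) ∷ A) x y
      (trans (rowStep p e₁) (rowSettle-bump refl) ,
       trans (colStep q e₂) (colSettle-stay (λ e → NP.1+n≰n (subst (_≤ px) (sym e) k≤px))) ,
       trans (colStep p e₃) (colSettle-bump refl) ,
       trans (rowStep (nextColEnd px A) e₄) (rowSettle-bump (sym col)))
      (cong₂ (λ c B → (n , c) ∷ B) (sym ends) eq ,
       inj₁ ((λ e → NP.1+n≢n (trans (cong proj₂ e) col)) , cong (suc px ,_) (sym col) , ends))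
    where
    adds₃ = proj₂ (proj₂ (valid₃ e₃))
    col : colLen (suc px) A ≡ py
    col = begin
      colLen (suc px) A
        ≡⟨ cong (_+ colLen (suc px) A) (δ-≢ (NP.<⇒≢ (NP.n<1+n px))) ⟨
      δ px (suc px) + colLen (suc px) A
        ≡⟨ proj₂ adds₃ (suc px) ⟨
      colLen (suc px) B₁
        ≡⟨ proj₂ (proj₁ (valid₄ e₃ e₄)) ⟩
      py ∎
      where open ≡-Reasoning
    ends : nextRowEnd (colLen (suc px) A) B₁ ≡ q
    ends rewrite col = cong (_, suc py) (rowLen-nextRow B₁ {p} adds₃ (NP.<⇒≢ (NP.n<1+n py)))

commute-top : ∀ A x y → Standard A → Fresh x A → AllBelow y A → x ≢ y → Commute A x y
commute-top A x y s fx l x≢y with y <E x in y<x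
... | true  = commute-bothTop s l y<x
... | false = commute-rowTop s fx l y<x x≢y

-- For a and b the boxes created in A by inserting y and x: the case a ≠ p = b is the
-- transpose of a = p ≠ b, and b′ above p is the transpose of b′ to the right of p.
commute-below : ∀ {n px py A x y} → Standard ((n , (px , py)) ∷ A) → Fresh x A → Fresh y A → x ≢ y →
  (n <E x) ≡ false → (n <E y) ≡ false → Commute A x y → Commute ((n , (px , py)) ∷ A) x y
commute-below {n} {px} {py} {A} {x} {y} s fx fy x≢y n≮x n≮y ih =
  cases (proj₂ (rowInsert y A) ≟ (px , py)) (proj₂ (colInsert x A) ≟ (px , py))
  where
  _≟_ = ≡-dec N._≟_ N._≟_
  ihᵀ = Commute-ᵀ⁻¹ A x y ih
  cases : Dec (proj₂ (rowInsert y A) ≡ (px , py)) → Dec (proj₂ (colInsert x A) ≡ (px , py)) →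
          Commute ((n , (px , py)) ∷ A) x y
  cases (no a≢p)  (no b≢p)  = commute-stay s fx fy x≢y n≮x n≮y (refl , refl , refl , refl) ih a≢p b≢p
  cases (yes a≡p) (no b≢p)  = commute-rowBump s fx fy x≢y n≮x n≮y (refl , refl , refl , refl) ih a≡p b≢p
  cases (no a≢p)  (yes b≡p) =
    Commute-ᵀ ((n , (px , py)) ∷ A) x y
      (commute-rowBump (Standard-ᵀ _ s) (All-ᵀ A fy) (All-ᵀ A fx) (≢-sym x≢y) n≮y n≮x
         (refl , refl , refl , refl) ihᵀ (cong swap b≡p)
         (a≢p ∘ cong swap ∘ trans (sym (cong proj₂ (colInsert-ᵀ y A)))))
  cases (yes a≡p) (yes b≡p) with proj₂ ih
  ... | inj₁ (a≢b , _) = ⊥-elim (a≢b (trans a≡p (sym b≡p)))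
  ... | inj₂ (_ , _ , inj₁ right) =
    commute-bothBump s fx fy x≢y n≮x n≮y (refl , refl , refl , refl) ih a≡p b≡p
      (trans right (cong (λ c → suc (proj₁ c) , proj₂ c) a≡p))
  ... | inj₂ (_ , b′≡a′ , inj₂ up) =
    Commute-ᵀ ((n , (px , py)) ∷ A) x y
      (commute-bothBump (Standard-ᵀ _ s) (All-ᵀ A fy) (All-ᵀ A fx) (≢-sym x≢y) n≮y n≮x
         (refl , refl , refl , refl) ihᵀ (cong swap b≡p)
         (trans (cong proj₂ (colInsert-ᵀ y A)) (cong swap a≡p))
         (cong swap (trans (sym b′≡a′) (trans up (cong (λ c → proj₁ c , suc (proj₂ c)) a≡p)))))

row-col-commute : ∀ A x y → Standard A → Fresh x A → Fresh y A → x ≢ y → Commute A x y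
row-col-commute [] x y _ _ _ x≢y = commute-top [] x y tt [] [] x≢y
row-col-commute ((n , (px , py)) ∷ A) x y s (x≢n ∷ fx) (y≢n ∷ fy) x≢y =
  compare (n <E y) refl (n <E x) refl
  where
  compare : ∀ b → (n <E y) ≡ b → ∀ b′ → (n <E x) ≡ b′ → Commute ((n , (px , py)) ∷ A) x y
  compare true  n<y _     _   = commute-top _ x y s (x≢n ∷ fx) (n<y ∷ AllBelow-trans A n<y (proj₁ s)) x≢y
  compare false _   true  n<x =
    Commute-ᵀ ((n , (px , py)) ∷ A) x y (commute-top _ y x (Standard-ᵀ _ s) (All-ᵀ _ (y≢n ∷ fy))
                                 (All-ᵀ _ (n<x ∷ AllBelow-trans A n<x (proj₁ s))) (≢-sym x≢y))
  compare false n≮y false n≮x =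
    commute-below s fx fy x≢y n≮x n≮y (row-col-commute A x y (proj₂ (proj₂ s)) fx fy x≢y)

-- Schensted's transposition theorem

rowTableau : List Ext → Filling
rowTableau = L.foldl _←ʳ_ []

colTableau : List Ext → Filling
colTableau = L.foldr _→ᶜ_ []

Unique-++⁻ˡ : ∀ {X : Set} (u : List X) {w} → Unique (u ++ w) → Unique u
Unique-++⁻ˡ []      _       = []
Unique-++⁻ˡ (a ∷ u) (h ∷ d) = AllP.++⁻ˡ u h ∷ Unique-++⁻ˡ u d

Unique-∷ʳ⁻ : ∀ {X : Set} (u : List X) {v} → Unique (u ∷ʳ v) → All (_≢ v) u
Unique-∷ʳ⁻ []      _       = []
Unique-∷ʳ⁻ (a ∷ u) (h ∷ d) with AllP.++⁻ʳ u h
... | a≢v ∷ [] = a≢v ∷ Unique-∷ʳ⁻ u d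

colTableau-All : ∀ {Q : Ext → Set} w → All Q w → All (Q ∘ proj₁) (colTableau w)
colTableau-All []      []       = []
colTableau-All (v ∷ w) (q ∷ qs) = colInsert-All v (colTableau w) (colTableau-All w qs) q

colTableau-standard : ∀ w → Unique w → Standard (colTableau w)
colTableau-standard []      []      = tt
colTableau-standard (v ∷ w) (h ∷ d) =
  proj₁ (proj₂ (colInsert-valid v (colTableau w) (colTableau-standard w d) (colTableau-All w h)))

rowInsert-colTableau : ∀ w y → Unique (w ∷ʳ y) → colTableau w ←ʳ y ≡ colTableau (w ∷ʳ y)
rowInsert-colTableau []      y _       = refl
rowInsert-colTableau (a ∷ w) y (h ∷ d) = begin
  (a →ᶜ colTableau w) ←ʳ y
    ≡⟨ proj₁ (row-col-commute (colTableau w) a y sw fa fy (All.head (AllP.++⁻ʳ w h))) ⟨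
  a →ᶜ (colTableau w ←ʳ y)
    ≡⟨ cong (a →ᶜ_) (rowInsert-colTableau w y d) ⟩
  a →ᶜ colTableau (w ∷ʳ y) ∎
  where
  open ≡-Reasoning
  sw = colTableau-standard w (Unique-++⁻ˡ w d)
  fa = colTableau-All w (AllP.++⁻ˡ w h)
  fy = colTableau-All w (All.map ≢-sym (Unique-∷ʳ⁻ w d))

rowInserts-colTableau : ∀ u w → Unique (u ++ w) → L.foldl _←ʳ_ (colTableau u) w ≡ colTableau (u ++ w)
rowInserts-colTableau u []      _ = cong colTableau (sym (LP.++-identityʳ u))
rowInserts-colTableau u (v ∷ w) d = begin
  L.foldl _←ʳ_ (colTableau u ←ʳ v) w
    ≡⟨ cong (λ A → L.foldl _←ʳ_ A w) (rowInsert-colTableau u v (Unique-++⁻ˡ (u ∷ʳ v) d′)) ⟩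
  L.foldl _←ʳ_ (colTableau (u ∷ʳ v)) w
    ≡⟨ rowInserts-colTableau (u ∷ʳ v) w d′ ⟩
  colTableau ((u ∷ʳ v) ++ w)
    ≡⟨ cong colTableau (LP.++-assoc u (v ∷ []) w) ⟩
  colTableau (u ++ v ∷ w) ∎
  where
  open ≡-Reasoning
  d′ : Unique ((u ∷ʳ v) ++ w)
  d′ = subst Unique (sym (LP.++-assoc u (v ∷ []) w)) d

rowTableau≡colTableau : ∀ w → Unique w → rowTableau w ≡ colTableau w
rowTableau≡colTableau = rowInserts-colTableau []

colTableau-ᵀ : ∀ w → colTableau w ᵀ ≡ rowTableau (L.reverse w)
colTableau-ᵀ []      = refl
colTableau-ᵀ (v ∷ w) = begin
  (v →ᶜ colTableau w) ᵀ              ≡⟨ ᵀ-involutive (colTableau w ᵀ ←ʳ v) ⟩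
  colTableau w ᵀ ←ʳ v                ≡⟨ cong (_←ʳ v) (colTableau-ᵀ w) ⟩
  rowTableau (L.reverse w) ←ʳ v      ≡⟨ LP.foldl-∷ʳ _←ʳ_ [] v (L.reverse w) ⟨
  rowTableau (L.reverse w ∷ʳ v)      ≡⟨ cong rowTableau (LP.unfold-reverse v w) ⟨
  rowTableau (L.reverse (v ∷ w))     ∎
  where open ≡-Reasoning

rowTableau-reverse : ∀ w → Unique w → rowTableau (L.reverse w) ≡ rowTableau w ᵀ
rowTableau-reverse w d = trans (sym (colTableau-ᵀ w)) (cong _ᵀ (sym (rowTableau≡colTableau w d)))

rowTableau-standard : ∀ w → Unique w → Standard (rowTableau w)
rowTableau-standard w d = subst Standard (sym (rowTableau≡colTableau w d)) (colTableau-standard w d)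

-- Tableaux as lists of rows

appendToRow : ℕ → Ext → Tableau → Tableau
appendToRow zero    n []       = (n ∷ []) ∷ []
appendToRow zero    n (r ∷ rs) = (r ∷ʳ n) ∷ rs
appendToRow (suc i) n []       = [] ∷ appendToRow i n []
appendToRow (suc i) n (r ∷ rs) = r ∷ appendToRow i n rs

toTableau : Filling → Tableau
toTableau []                  = []
toTableau ((n , (x , y)) ∷ A) = appendToRow y n (toTableau A)

stopRow : Tableau → Ext → ℕ
stopRow []       v = 0
stopRow (r ∷ rs) v with insRow v r
... | nothing , _ = 0
... | just b  , _ = suc (stopRow rs b)

AllT : (Ext → Set) → Tableau → Set
AllT Q = All (All Q)

appendToRow-All : ∀ {Q : Ext → Set} i n T → AllT Q T → Q n → AllT Q (appendToRow i n T)
appendToRow-All zero    n []       _        q = (q ∷ []) ∷ []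
appendToRow-All zero    n (r ∷ rs) (h ∷ hs) q = AllP.++⁺ h (q ∷ []) ∷ hs
appendToRow-All (suc i) n []       _        q = [] ∷ appendToRow-All i n [] [] q
appendToRow-All (suc i) n (r ∷ rs) (h ∷ hs) q = h ∷ appendToRow-All i n rs hs q

toTableau-All : ∀ {Q : Ext → Set} A → All (Q ∘ proj₁) A → AllT Q (toTableau A)
toTableau-All []                  []       = []
toTableau-All ((n , (x , y)) ∷ A) (q ∷ qs) = appendToRow-All y n (toTableau A) (toTableau-All A qs) q

insRow-max : ∀ v r → All (λ e → (v <E e) ≡ false) r → insRow v r ≡ (nothing , r ∷ʳ v)
insRow-max v []      _        = refl
insRow-max v (b ∷ r) (h ∷ hs) rewrite h | insRow-max v r hs = refl

insert-max : ∀ v T → AllT (λ e → (v <E e) ≡ false) T →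
             insert T v ≡ appendToRow 0 v T × stopRow T v ≡ 0
insert-max v []       _       = refl , refl
insert-max v (r ∷ rs) (h ∷ _) rewrite insRow-max v r h = refl , refl

bumpLast : Ext → Maybe Ext × List Ext → Maybe Ext × List Ext
bumpLast n (just b  , r′) = just b , r′ ∷ʳ n
bumpLast n (nothing , r′) = just n , r′

insRow-∷ʳ : ∀ v n r → (v <E n) ≡ true → insRow v (r ∷ʳ n) ≡ bumpLast n (insRow v r)
insRow-∷ʳ v n []      v<n rewrite v<n = refl
insRow-∷ʳ v n (b ∷ r) v<n with v <E b
... | true  = refl
... | false rewrite insRow-∷ʳ v n r v<n with insRow v r
... | just c  , r′ = refl
... | nothing , r′ = refl

insRow-bumped : ∀ {Q : Ext → Set} v r {b r′} → insRow v r ≡ (just b , r′) → All Q r → Q b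
insRow-bumped v (c ∷ r) e (q ∷ qs) with v <E c
insRow-bumped v (c ∷ r) refl (q ∷ qs) | true = q
... | false with insRow v r in e′
insRow-bumped v (c ∷ r) refl (q ∷ qs) | false | just _ , _ = insRow-bumped v r e′ qs

module _ {n : Ext} where

  private
    AllBelowT : Tableau → Set
    AllBelowT = AllT (λ e → (e <E n) ≡ true)

    notAbove : ∀ {T} → AllBelowT T → AllT (λ e → (n <E e) ≡ false) T
    notAbove = All.map (All.map (λ {e} e<n → <E-asym e n e<n))

  insert-appendToRow-stop : ∀ {v} i T → AllBelowT T → (v <E n) ≡ true → stopRow T v ≡ i →
    insert (appendToRow i n T) v ≡ appendToRow (suc i) n (insert T v) × stopRow (appendToRow i n T) v ≡ suc i
  insert-appendToRow-stop zero [] _ v<n _ rewrite v<n = refl , refl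
  insert-appendToRow-stop {v} zero (r ∷ rs) (_ ∷ hs) v<n stop rewrite insRow-∷ʳ v n r v<n with insRow v r
  ... | nothing , r′ = cong (r′ ∷_) (proj₁ (insert-max n rs (notAbove hs))) ,
                       cong suc (proj₂ (insert-max n rs (notAbove hs)))
  insert-appendToRow-stop {v} (suc i) (r ∷ rs) (h ∷ hs) v<n stop with insRow v r in e
  ... | just b , r′ = cong (r′ ∷_) (proj₁ ih) , cong suc (proj₂ ih)
    where ih = insert-appendToRow-stop i rs hs (insRow-bumped v r e h) (NP.suc-injective stop)

  insert-appendToRow-pass : ∀ {v} i T → AllBelowT T → (v <E n) ≡ true → stopRow T v ≢ i →
    insert (appendToRow i n T) v ≡ appendToRow i n (insert T v) × stopRow (appendToRow i n T) v ≡ stopRow T v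
  insert-appendToRow-pass zero [] _ _ pass = ⊥-elim (pass refl)
  insert-appendToRow-pass (suc i) [] _ _ _ = refl , refl
  insert-appendToRow-pass {v} zero (r ∷ rs) _ v<n pass rewrite insRow-∷ʳ v n r v<n with insRow v r
  ... | nothing , _ = ⊥-elim (pass refl)
  ... | just b  , _ = refl , refl
  insert-appendToRow-pass {v} (suc i) (r ∷ rs) (h ∷ hs) v<n pass with insRow v r in e
  ... | nothing , _ = refl , refl
  ... | just b  , r′ = cong (r′ ∷_) (proj₁ ih) , cong suc (proj₂ ih)
    where ih = insert-appendToRow-pass i rs hs (insRow-bumped v r e h) (pass ∘ cong suc)

insert-toTableau : ∀ v A → Standard A → Fresh v A →
  insert (toTableau A) v ≡ toTableau (A ←ʳ v) × stopRow (toTableau A) v ≡ proj₂ (proj₂ (rowInsert v A))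
insert-toTableau v []                    _ _ = refl , refl
insert-toTableau v ((n , (px , py)) ∷ A) s (v≢n ∷ f) with n <E v in n<v
... | true  = insert-max v _ (toTableau-All ((n , (px , py)) ∷ A)
                (All.map (λ {q} q<v → <E-asym (proj₁ q) v q<v) (n<v ∷ AllBelow-trans A n<v (proj₁ s))))
... | false = settle (proj₂ (proj₂ (rowInsert v A)) N.≟ py)
  where
  T₀ = toTableau A
  Goal : Filling × Pos → Set
  Goal r = insert (appendToRow py n T₀) v ≡ toTableau (proj₁ r)
         × stopRow (appendToRow py n T₀) v ≡ proj₂ (proj₂ r)
  ih = insert-toTableau v A (proj₂ (proj₂ s)) f
  below = toTableau-All A (proj₁ s)
  v<n = <E-connex n v (≢-sym v≢n) n<v
  settle : Dec (proj₂ (proj₂ (rowInsert v A)) ≡ py) → Goal (rowSettle n (px , py) A (rowInsert v A))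
  settle (yes stop) =
    subst Goal (sym (rowSettle-bump stop))
      (Product.map₁ (λ e → trans e (cong (appendToRow (suc py) n) (proj₁ ih)))
                    (insert-appendToRow-stop py T₀ below v<n (trans (proj₂ ih) stop)))
  settle (no pass) =
    subst Goal (sym (rowSettle-stay pass))
      (Product.zip trans trans (insert-appendToRow-pass py T₀ below v<n (pass ∘ trans (sym (proj₂ ih))))
                               (cong (appendToRow py n) (proj₁ ih) , proj₂ ih))

inserts-toTableau : ∀ w A → Standard A → Unique w → All (λ v → Fresh v A) w →
  L.foldl insert (toTableau A) w ≡ toTableau (L.foldl _←ʳ_ A w)
inserts-toTableau []      A _ _       _         = refl
inserts-toTableau (v ∷ w) A s (h ∷ d) (fv ∷ fs) = begin
  L.foldl insert (insert (toTableau A) v) w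
    ≡⟨ cong (λ T → L.foldl insert T w) (proj₁ (insert-toTableau v A s fv)) ⟩
  L.foldl insert (toTableau (A ←ʳ v)) w
    ≡⟨ inserts-toTableau w (A ←ʳ v) (proj₁ (proj₂ (rowInsert-valid v A s fv))) d fs′ ⟩
  toTableau (L.foldl _←ʳ_ (A ←ʳ v) w) ∎
  where
  open ≡-Reasoning
  fs′ : All (λ u → Fresh u (A ←ʳ v)) w
  fs′ = All.zipWith (λ (fu , v≢u) → rowInsert-All v A fu (≢-sym v≢u)) (fs , h)

P≡toTableau : ∀ w → Unique w → P w ≡ toTableau (rowTableau w)
P≡toTableau w d = inserts-toTableau w [] tt d (All.universal (λ _ → []) w)

applyUpTo-cong : ∀ {f g : ℕ → ℕ} n → (∀ i → f i ≡ g i) → L.applyUpTo f n ≡ L.applyUpTo g n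
applyUpTo-cong zero    f≗g = refl
applyUpTo-cong (suc n) f≗g = cong₂ _∷_ (f≗g 0) (applyUpTo-cong n (f≗g ∘ suc))

count>-++ : ∀ j xs ys → count> j (xs ++ ys) ≡ count> j xs + count> j ys
count>-++ j xs ys = trans (cong L.length (LP.filter-++ (λ n → T? (j <ᵇ n)) xs ys)) (LP.length-++ (L.filter _ xs))

count>-[_] : ∀ {j} x → count> j (x ∷ []) ≡ (if j <ᵇ x then 1 else 0)
count>-[_] {j} x with j <ᵇ x
... | true  = refl
... | false = refl

module _ {R C : ℕ → ℕ} (dual : Conjugate R C) where

  count>-applyUpTo : ∀ j h → count> j (L.applyUpTo R h) ≡ h ⊓ C j
  count>-applyUpTo j zero    = refl
  count>-applyUpTo j (suc h) = begin
    count> j (L.applyUpTo R (suc h))            ≡⟨ cong (count> j) (LP.applyUpTo-∷ʳ R h) ⟨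
    count> j (L.applyUpTo R h ∷ʳ R h)           ≡⟨ count>-++ j (L.applyUpTo R h) (R h ∷ []) ⟩
    count> j (L.applyUpTo R h) + count> j (R h ∷ []) ≡⟨ cong₂ _+_ (count>-applyUpTo j h) count>-[ R h ] ⟩
    h ⊓ C j + (if j <ᵇ R h then 1 else 0)       ≡⟨ step (h N.<? C j) ⟩
    suc h ⊓ C j                                 ∎
    where
    open ≡-Reasoning
    step : Dec (h < C j) → h ⊓ C j + (if j <ᵇ R h then 1 else 0) ≡ suc h ⊓ C j
    step (yes h<C)
      rewrite to T-≡ (NP.<⇒<ᵇ (proj₂ dual h j h<C)) | NP.m≤n⇒m⊓n≡m (NP.<⇒≤ h<C) | NP.m≤n⇒m⊓n≡m h<C
      = NP.+-comm h 1
    step (no h≮C) with j <ᵇ R h in j<R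
    ... | true  = ⊥-elim (h≮C (proj₁ dual j h (NP.<ᵇ⇒< j (R h) (from T-≡ j<R))))
    ... | false
      rewrite NP.m≥n⇒m⊓n≡n (NP.≮⇒≥ h≮C) | NP.m≥n⇒m⊓n≡n (NP.m≤n⇒m≤1+n (NP.≮⇒≥ h≮C))
      = NP.+-identityʳ (C j)

  conj-applyUpTo : conj (L.applyUpTo R (C 0)) ≡ L.applyUpTo C (R 0)
  conj-applyUpTo with C 0 in c₀
  ... | zero  rewrite col0-empty⇒row0-empty dual c₀ = refl
  ... | suc k = trans (LP.map-upTo _ (R 0)) (applyUpTo-cong (R 0) λ j →
                  trans (count>-applyUpTo j (suc k))
                        (NP.m≥n⇒m⊓n≡n (subst (C j ≤_) c₀ (conjugate-antitone (swap dual) z≤n))))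

Finite : Ext → Set
Finite e = T (not (isInf e))

rowLength : ℕ → Tableau → ℕ
rowLength _       []       = 0
rowLength zero    (r ∷ _)  = L.length r
rowLength (suc i) (_ ∷ rs) = rowLength i rs

shapeOf : Filling → YD
shapeOf A = L.applyUpTo (rows A) (colLen 0 A)

findInfRow-finite : ∀ r → All Finite r → findInfRow r ≡ nothing
findInfRow-finite []          _        = refl
findInfRow-finite (fin k ∷ r) (_ ∷ hs) rewrite findInfRow-finite r hs = refl

findInfRow-∷ʳ∞ : ∀ r → All Finite r → findInfRow (r ∷ʳ ∞) ≡ just (L.length r)
findInfRow-∷ʳ∞ []          _        = refl
findInfRow-∷ʳ∞ (fin k ∷ r) (_ ∷ hs) rewrite findInfRow-∷ʳ∞ r hs = refl

findInf-appendToRow : ∀ i T → AllT Finite T → findInf (appendToRow i ∞ T) ≡ just (rowLength i T , i)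
findInf-appendToRow zero    []       _        = refl
findInf-appendToRow zero    (r ∷ rs) (h ∷ _)  rewrite findInfRow-∷ʳ∞ r h = refl
findInf-appendToRow (suc i) []       _        rewrite findInf-appendToRow i [] [] = refl
findInf-appendToRow (suc i) (r ∷ rs) (h ∷ hs) rewrite findInfRow-finite r h | findInf-appendToRow i rs hs = refl

rowLength-appendToRow : ∀ i j n T → rowLength i (appendToRow j n T) ≡ δ j i + rowLength i T
rowLength-appendToRow zero    zero    n []       = refl
rowLength-appendToRow (suc i) zero    n []       = refl
rowLength-appendToRow zero    zero    n (r ∷ rs) = trans (LP.length-++ r) (NP.+-comm (L.length r) 1)
rowLength-appendToRow (suc i) zero    n (r ∷ rs) = refl
rowLength-appendToRow zero    (suc j) n []       = refl
rowLength-appendToRow (suc i) (suc j) n []       = rowLength-appendToRow i j n []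
rowLength-appendToRow zero    (suc j) n (r ∷ rs) = refl
rowLength-appendToRow (suc i) (suc j) n (r ∷ rs) = rowLength-appendToRow i j n rs

rowLength-toTableau : ∀ i A → rowLength i (toTableau A) ≡ rowLen i A
rowLength-toTableau i []                  = refl
rowLength-toTableau i ((n , (x , y)) ∷ A) =
  trans (rowLength-appendToRow i y n (toTableau A)) (cong (δ y i +_) (rowLength-toTableau i A))

positives : List ℕ → List ℕ
positives = L.filter (λ n → T? (isPos n))

dropInf : List Ext → List Ext
dropInf = L.filter (λ e → T? (not (isInf e)))

dropInf-finite : ∀ {r} → All Finite r → dropInf r ≡ r
dropInf-finite = LP.filter-all (λ e → T? (not (isInf e)))

dropInf-∷ʳ∞ : ∀ {r} → All Finite r → dropInf (r ∷ʳ ∞) ≡ r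
dropInf-∷ʳ∞ {r} h = trans (LP.filter-++ (λ e → T? (not (isInf e))) r (∞ ∷ []))
                          (trans (LP.++-identityʳ (dropInf r)) (dropInf-finite h))

finiteLengths : Tableau → List ℕ
finiteLengths = L.map (L.length ∘ dropInf)

finiteLengths-finite : ∀ T → AllT Finite T → finiteLengths T ≡ L.map L.length T
finiteLengths-finite []       _        = refl
finiteLengths-finite (r ∷ rs) (h ∷ hs) = cong₂ _∷_ (cong L.length (dropInf-finite h)) (finiteLengths-finite rs hs)

positives-∷ : ∀ x {l l′} → positives l ≡ positives l′ → positives (x ∷ l) ≡ positives (x ∷ l′)
positives-∷ zero    e = e
positives-∷ (suc x) e = cong (suc x ∷_) e

-- Rows padded below the tableau to reach row i have length zero and are dropped again.
shapeWithoutInf-appendToRow : ∀ i T → AllT Finite T →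
                              shapeWithoutInf (appendToRow i ∞ T) ≡ positives (L.map L.length T)
shapeWithoutInf-appendToRow zero    []       _        = refl
shapeWithoutInf-appendToRow zero    (r ∷ rs) (h ∷ hs) =
  cong positives (cong₂ _∷_ (cong L.length (dropInf-∷ʳ∞ h)) (finiteLengths-finite rs hs))
shapeWithoutInf-appendToRow (suc i) []       _        = shapeWithoutInf-appendToRow i [] []
shapeWithoutInf-appendToRow (suc i) (r ∷ rs) (h ∷ hs) =
  trans (cong (λ c → positives (L.length c ∷ finiteLengths (appendToRow i ∞ rs))) (dropInf-finite h))
        (positives-∷ (L.length r) (shapeWithoutInf-appendToRow i rs hs))

δ-resp : ∀ {a b c d} → (a ≡ b → c ≡ d) → (c ≡ d → a ≡ b) → δ a b ≡ δ c d
δ-resp {a} {b} {c} {d} ⇒ ⇐ with a N.≟ b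
... | yes refl rewrite ⇒ refl | δ-refl a | δ-refl d = refl
... | no a≢b rewrite δ-≢ a≢b | δ-≢ (a≢b ∘ ⇐) = refl

NonEmptyRow : List Ext → Set
NonEmptyRow r = T (isPos (L.length r))

appendToRow-shape : ∀ i n T → i ≤ L.length T → All NonEmptyRow T →
  All NonEmptyRow (appendToRow i n T) × L.length (appendToRow i n T) ≡ δ i (L.length T) + L.length T
appendToRow-shape zero    n []       _         _        = tt ∷ [] , refl
appendToRow-shape zero    n (r ∷ rs) _         (_ ∷ hs) =
  subst (T ∘ isPos) (sym (LP.length-++ r)) (nonzero (L.length r)) ∷ hs , refl
  where
  nonzero : ∀ m → T (isPos (m + 1))
  nonzero zero    = tt
  nonzero (suc m) = tt
appendToRow-shape (suc i) n (r ∷ rs) (s≤s i≤) (h ∷ hs) =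
  h ∷ proj₁ ih , trans (cong suc (proj₂ ih)) (sym (NP.+-suc (δ i (L.length rs)) (L.length rs)))
  where ih = appendToRow-shape i n rs i≤ hs

toTableau-shape : ∀ B → Standard B → All NonEmptyRow (toTableau B) × L.length (toTableau B) ≡ colLen 0 B
toTableau-shape []                    _                 = [] , refl
toTableau-shape ((n , (px , py)) ∷ B) (_ , (r , c) , s) =
  proj₁ step ,
  trans (proj₂ step) (cong₂ _+_ (trans (cong (δ py) (proj₂ ih)) (δ-resp row⇒col col⇒row)) (proj₂ ih))
  where
  ih = toTableau-shape B s
  dual = standard⇒conjugate B s
  py≤ : py ≤ L.length (toTableau B)
  py≤ = subst (py ≤_) (sym (proj₂ ih)) (subst (_≤ colLen 0 B) c (conjugate-antitone (swap dual) z≤n))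
  step = appendToRow-shape py n (toTableau B) py≤ (proj₁ ih)
  row⇒col : py ≡ colLen 0 B → px ≡ 0
  row⇒col e =
    NP.n≤0⇒n≡0 (subst (_≤ 0) (trans (cong (λ y → rowLen y B) (sym e)) r) (fit-rowEnd (proj₁ dual) 0))
  col⇒row : px ≡ 0 → py ≡ colLen 0 B
  col⇒row e = trans (sym c) (cong (λ x → colLen x B) e)

map-length-rowLength : ∀ T → L.map L.length T ≡ L.applyUpTo (λ i → rowLength i T) (L.length T)
map-length-rowLength []       = refl
map-length-rowLength (r ∷ rs) = cong (L.length r ∷_) (map-length-rowLength rs)

positives-toTableau : ∀ B → Standard B → positives (L.map L.length (toTableau B)) ≡ shapeOf B
positives-toTableau B s = begin
  positives (L.map L.length (toTableau B))
    ≡⟨ LP.filter-all (λ n → T? (isPos n)) (AllP.map⁺ (proj₁ (toTableau-shape B s))) ⟩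
  L.map L.length (toTableau B)
    ≡⟨ map-length-rowLength (toTableau B) ⟩
  L.applyUpTo (λ i → rowLength i (toTableau B)) (L.length (toTableau B))
    ≡⟨ cong (L.applyUpTo (λ i → rowLength i (toTableau B))) (proj₂ (toTableau-shape B s)) ⟩
  L.applyUpTo (λ i → rowLength i (toTableau B)) (colLen 0 B)
    ≡⟨ applyUpTo-cong (colLen 0 B) (λ i → rowLength-toTableau i B) ⟩
  shapeOf B ∎
  where open ≡-Reasoning

toTableau-finite : ∀ B → AllBelow ∞ B → AllT Finite (toTableau B)
toTableau-finite B l = toTableau-All B (All.map (λ {q} q<∞ → below∞ (proj₁ q) q<∞) l)
  where
  below∞ : ∀ e → (e <E ∞) ≡ true → Finite e
  below∞ (fin _) _ = tt

shStar-toTableau : ∀ px py B → Standard ((∞ , (px , py)) ∷ B) →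
  shStar (toTableau ((∞ , (px , py)) ∷ B)) ≡ just (shapeOf B , (px , py))
shStar-toTableau px py B (l , (r , c) , s) rewrite findInf-appendToRow py (toTableau B) (toTableau-finite B l) =
  cong₂ (λ sh q → just (sh , q))
        (trans (shapeWithoutInf-appendToRow py (toTableau B) (toTableau-finite B l)) (positives-toTableau B s))
        (cong (_, py) (trans (rowLength-toTableau py B) r))

conj-shapeOf-ᵀ : ∀ B → Standard B → conj (shapeOf (B ᵀ)) ≡ shapeOf B
conj-shapeOf-ᵀ B s = begin
  conj (L.applyUpTo (rows (B ᵀ)) (colLen 0 (B ᵀ)))
    ≡⟨ cong (λ c → conj (L.applyUpTo (rows (B ᵀ)) c)) (colLen-ᵀ 0 B) ⟩
  conj (L.applyUpTo (rows (B ᵀ)) (rowLen 0 B))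
    ≡⟨ cong conj (applyUpTo-cong (rowLen 0 B) (λ i → rowLen-ᵀ i B)) ⟩
  conj (L.applyUpTo (cols B) (rowLen 0 B))
    ≡⟨ conj-applyUpTo (swap (standard⇒conjugate B s)) ⟩
  shapeOf B ∎
  where open ≡-Reasoning

rowInserts-entries : ∀ w A → entries (L.foldl _←ʳ_ A w) ↭ w ++ entries A
rowInserts-entries []      A = Perm.↭-refl
rowInserts-entries (v ∷ w) A =
  Perm.↭-trans (rowInserts-entries w (A ←ʳ v))
    (Perm.↭-trans (PermP.++⁺ˡ w (rowInsert-entries v A)) (PermP.shift v w (entries A)))

rowTableau-entries : ∀ w → entries (rowTableau w) ↭ w
rowTableau-entries w = Perm.↭-trans (rowInserts-entries w []) (Perm.↭-reflexive (LP.++-identityʳ w))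

∞-head : ∀ A → Standard A → ∞ ∈ entries A → Σ[ p ∈ Pos ] Σ[ B ∈ Filling ] A ≡ (∞ , p) ∷ B
∞-head ((∞ , p) ∷ B)     _       _           = p , B , refl
∞-head ((fin k , p) ∷ B) (l , _) (there ∞∈B) with All.lookup (AllP.map⁺ l) ∞∈B
... | ()

-- Words and permutations

Unique-↭ : ∀ {X : Set} {xs ys : List X} → xs ↭ ys → Unique xs → Unique ys
Unique-↭ {X} p = Unique-resp-↭ (Perm.↭⇒↭ₛ p)
  where open import Data.List.Relation.Binary.Permutation.Setoid.Properties (setoid X) using (Unique-resp-↭)

word-↭ : ∀ m σ → word m σ ↭ ∞ ∷ L.map fin σ
word-↭ m σ = Perm.↭-trans (PermP.shift ∞ (L.map fin (L.take m σ)) (L.map fin (L.drop m σ)))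
  (Perm.↭-reflexive (cong (∞ ∷_) (trans (sym (LP.map-++ fin (L.take m σ) (L.drop m σ)))
                                        (cong (L.map fin) (LP.take++drop≡id m σ)))))

Unique-word : ∀ m σ → Unique σ → Unique (word m σ)
Unique-word m σ d =
  Unique-↭ (Perm.↭-sym (word-↭ m σ))
           (AllP.map⁺ (All.universal (λ _ ()) σ) ∷ UniqueP.map⁺ fin-injective d)
  where
  fin-injective : ∀ {a b} → fin a ≡ fin b → a ≡ b
  fin-injective refl = refl

∞∈word : ∀ m σ → ∞ ∈ word m σ
∞∈word m σ = AnyP.++⁺ʳ (L.map fin (L.take m σ)) (here refl)

take-length-++ : ∀ {X : Set} (xs ys : List X) → L.take (L.length xs) (xs ++ ys) ≡ xs
take-length-++ []       ys = refl
take-length-++ (x ∷ xs) ys = cong (x ∷_) (take-length-++ xs ys)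

drop-length-++ : ∀ {X : Set} (xs ys : List X) → L.drop (L.length xs) (xs ++ ys) ≡ ys
drop-length-++ []       ys = refl
drop-length-++ (x ∷ xs) ys = drop-length-++ xs ys

word-reverse : ∀ m m′ σ → L.length σ ≡ m + m′ → word m′ (L.reverse σ) ≡ L.reverse (word m σ)
word-reverse m m′ σ len = begin
  word m′ (L.reverse σ)
    ≡⟨ cong₂ (λ u v → L.map fin u ++ ∞ ∷ L.map fin v) take′ drop′ ⟩
  L.map fin (L.reverse ys) ++ ∞ ∷ L.map fin (L.reverse xs)
    ≡⟨ cong₂ (λ u v → u ++ ∞ ∷ v) (LP.reverse-map fin ys) (LP.reverse-map fin xs) ⟩
  L.reverse (L.map fin ys) ++ ∞ ∷ L.reverse (L.map fin xs)
    ≡⟨ LP.∷ʳ-++ (L.reverse (L.map fin ys)) ∞ (L.reverse (L.map fin xs)) ⟨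
  (L.reverse (L.map fin ys) ∷ʳ ∞) ++ L.reverse (L.map fin xs)
    ≡⟨ cong (_++ L.reverse (L.map fin xs)) (LP.unfold-reverse ∞ (L.map fin ys)) ⟨
  L.reverse (∞ ∷ L.map fin ys) ++ L.reverse (L.map fin xs)
    ≡⟨ LP.reverse-++ (L.map fin xs) (∞ ∷ L.map fin ys) ⟨
  L.reverse (word m σ) ∎
  where
  open ≡-Reasoning
  xs = L.take m σ
  ys = L.drop m σ
  split : L.reverse σ ≡ L.reverse ys ++ L.reverse xs
  split = trans (cong L.reverse (sym (LP.take++drop≡id m σ))) (LP.reverse-++ xs ys)
  length-ys : L.length (L.reverse ys) ≡ m′
  length-ys = trans (LP.length-reverse ys)
                    (trans (LP.length-drop m σ) (trans (cong (N._∸ m) len) (NP.m+n∸m≡n m m′)))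
  take′ : L.take m′ (L.reverse σ) ≡ L.reverse ys
  take′ = trans (cong₂ L.take (sym length-ys) split) (take-length-++ (L.reverse ys) (L.reverse xs))
  drop′ : L.drop m′ (L.reverse σ) ≡ L.reverse xs
  drop′ = trans (cong₂ L.drop (sym length-ys) split) (drop-length-++ (L.reverse ys) (L.reverse xs))

module _ {X : Set} where

  insertions-∷ʳ : ∀ (a : X) xs b →
    insertions a (xs ∷ʳ b) ≡ L.map (_∷ʳ b) (insertions a xs) ∷ʳ ((xs ∷ʳ b) ∷ʳ a)
  insertions-∷ʳ a []       b = refl
  insertions-∷ʳ a (x ∷ xs) b = cong ((a ∷ x ∷ xs ∷ʳ b) ∷_) (begin
    L.map (x ∷_) (insertions a (xs ∷ʳ b))
      ≡⟨ cong (L.map (x ∷_)) (insertions-∷ʳ a xs b) ⟩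
    L.map (x ∷_) (L.map (_∷ʳ b) (insertions a xs) ∷ʳ ((xs ∷ʳ b) ∷ʳ a))
      ≡⟨ LP.map-++ (x ∷_) (L.map (_∷ʳ b) (insertions a xs)) _ ⟩
    L.map (x ∷_) (L.map (_∷ʳ b) (insertions a xs)) ∷ʳ (x ∷ (xs ∷ʳ b) ∷ʳ a)
      ≡⟨ cong (_∷ʳ (x ∷ (xs ∷ʳ b) ∷ʳ a))
              (trans (sym (LP.map-∘ (insertions a xs))) (LP.map-∘ (insertions a xs))) ⟩
    L.map (_∷ʳ b) (L.map (x ∷_) (insertions a xs)) ∷ʳ (x ∷ (xs ∷ʳ b) ∷ʳ a) ∎)
    where open ≡-Reasoning

  insertions-reverse : ∀ (a : X) bs →
    L.map L.reverse (insertions a bs) ≡ L.reverse (insertions a (L.reverse bs))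
  insertions-reverse a []       = refl
  insertions-reverse a (b ∷ bs) = sym (begin
    L.reverse (insertions a (L.reverse (b ∷ bs)))
      ≡⟨ cong (λ z → L.reverse (insertions a z)) (LP.unfold-reverse b bs) ⟩
    L.reverse (insertions a (L.reverse bs ∷ʳ b))
      ≡⟨ cong L.reverse (insertions-∷ʳ a (L.reverse bs) b) ⟩
    L.reverse (L.map (_∷ʳ b) (insertions a (L.reverse bs)) ∷ʳ ((L.reverse bs ∷ʳ b) ∷ʳ a))
      ≡⟨ LP.reverse-++ (L.map (_∷ʳ b) (insertions a (L.reverse bs))) _ ⟩
    ((L.reverse bs ∷ʳ b) ∷ʳ a) ∷ L.reverse (L.map (_∷ʳ b) (insertions a (L.reverse bs)))
      ≡⟨ cong₂ _∷_ last (sym (LP.reverse-map (_∷ʳ b) (insertions a (L.reverse bs)))) ⟩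
    L.reverse (a ∷ b ∷ bs) ∷ L.map (_∷ʳ b) (L.reverse (insertions a (L.reverse bs)))
      ≡⟨ cong (λ z → L.reverse (a ∷ b ∷ bs) ∷ L.map (_∷ʳ b) z) (sym (insertions-reverse a bs)) ⟩
    L.reverse (a ∷ b ∷ bs) ∷ L.map (_∷ʳ b) (L.map L.reverse (insertions a bs))
      ≡⟨ cong (L.reverse (a ∷ b ∷ bs) ∷_) (begin
           L.map (_∷ʳ b) (L.map L.reverse (insertions a bs))  ≡⟨ LP.map-∘ (insertions a bs) ⟨
           L.map (λ l → L.reverse l ∷ʳ b) (insertions a bs)
             ≡⟨ LP.map-cong (λ l → sym (LP.unfold-reverse b l)) (insertions a bs) ⟩
           L.map (λ l → L.reverse (b ∷ l)) (insertions a bs)   ≡⟨ LP.map-∘ (insertions a bs) ⟩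
           L.map L.reverse (L.map (b ∷_) (insertions a bs))    ∎) ⟩
    L.reverse (a ∷ b ∷ bs) ∷ L.map L.reverse (L.map (b ∷_) (insertions a bs)) ∎)
    where
    open ≡-Reasoning
    last : (L.reverse bs ∷ʳ b) ∷ʳ a ≡ L.reverse (a ∷ b ∷ bs)
    last = sym (trans (LP.unfold-reverse a (b ∷ bs)) (cong (_∷ʳ a) (LP.unfold-reverse b bs)))

  concatMap-↭-pointwise : ∀ {f g : List X → List (List X)} xs → (∀ x → f x ↭ g x) →
                          L.concatMap f xs ↭ L.concatMap g xs
  concatMap-↭-pointwise []       f↭g = Perm.↭-refl
  concatMap-↭-pointwise (x ∷ xs) f↭g = PermP.++⁺ (f↭g x) (concatMap-↭-pointwise xs f↭g)

  concatMap-↭ : ∀ (f : List X → List (List X)) {xs ys} → xs ↭ ys → L.concatMap f xs ↭ L.concatMap f ys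
  concatMap-↭ f Perm.refl          = Perm.↭-refl
  concatMap-↭ f (Perm.prep x p)    = PermP.++⁺ˡ (f x) (concatMap-↭ f p)
  concatMap-↭ f (Perm.swap x y p)  =
    Perm.↭-trans (PermP.++⁺ˡ (f x) (PermP.++⁺ˡ (f y) (concatMap-↭ f p))) (PermP.shifts (f x) (f y))
  concatMap-↭ f (Perm.trans p q)   = Perm.↭-trans (concatMap-↭ f p) (concatMap-↭ f q)

  perms-reverse : ∀ (l : List X) → L.map L.reverse (perms l) ↭ perms l
  perms-reverse []       = Perm.↭-refl
  perms-reverse (a ∷ as) = begin
    L.map L.reverse (L.concatMap (insertions a) (perms as))
      ≡⟨ LP.map-concatMap L.reverse (insertions a) (perms as) ⟩
    L.concatMap (L.map L.reverse ∘ insertions a) (perms as)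
      ≡⟨ LP.concatMap-cong (insertions-reverse a) (perms as) ⟩
    L.concatMap (L.reverse ∘ insertions a ∘ L.reverse) (perms as)
      ↭⟨ concatMap-↭-pointwise (perms as) (λ σ → PermP.↭-reverse (insertions a (L.reverse σ))) ⟩
    L.concatMap (insertions a ∘ L.reverse) (perms as)
      ≡⟨ LP.concatMap-map (insertions a) L.reverse (perms as) ⟨
    L.concatMap (insertions a) (L.map L.reverse (perms as))
      ↭⟨ concatMap-↭ (insertions a) (perms-reverse as) ⟩
    L.concatMap (insertions a) (perms as) ∎
    where open Perm.PermutationReasoning

  insertions-↭ : ∀ (a : X) bs → All (_↭ a ∷ bs) (insertions a bs)
  insertions-↭ a []       = Perm.↭-refl ∷ []
  insertions-↭ a (b ∷ bs) =
    Perm.↭-refl ∷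
    AllP.map⁺ (All.map (λ p → Perm.↭-trans (Perm.prep b p) (Perm.swap b a Perm.↭-refl))
                       (insertions-↭ a bs))

  perms-↭ : ∀ (l : List X) → All (_↭ l) (perms l)
  perms-↭ []       = Perm.↭-refl ∷ []
  perms-↭ (a ∷ as) = AllP.concat⁺ (AllP.map⁺ (All.map
    (λ {σ} σ↭as → All.map (λ τ↭ → Perm.↭-trans τ↭ (Perm.prep a σ↭as)) (insertions-↭ a σ))
    (perms-↭ as)))

augPlancherel-reverse : ∀ m m′ σ → Unique σ → L.length σ ≡ m + m′ →
  augPlancherel m σ ≡ transposeAug (augPlancherel m′ (L.reverse σ))
augPlancherel-reverse m m′ σ d len =
  fromHead (∞-head (rowTableau w) s (PermP.∈-resp-↭ (Perm.↭-sym (rowTableau-entries w)) (∞∈word m σ)))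
  where
  w = word m σ
  dw = Unique-word m σ d
  s = rowTableau-standard w dw
  fromHead : Σ[ p ∈ Pos ] Σ[ B ∈ Filling ] rowTableau w ≡ (∞ , p) ∷ B →
             augPlancherel m σ ≡ transposeAug (augPlancherel m′ (L.reverse σ))
  fromHead ((px , py) , B , eq) = begin
    shStar (P w)
      ≡⟨ cong shStar (P≡toTableau w dw) ⟩
    shStar (toTableau (rowTableau w))
      ≡⟨ cong (shStar ∘ toTableau) eq ⟩
    shStar (toTableau ((∞ , (px , py)) ∷ B))
      ≡⟨ shStar-toTableau px py B sB ⟩
    just (shapeOf B , (px , py))
      ≡⟨ cong (λ sh → just (sh , (px , py))) (conj-shapeOf-ᵀ B (proj₂ (proj₂ sB))) ⟨
    transposeAug (just (shapeOf (B ᵀ) , (py , px)))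
      ≡⟨ cong transposeAug (shStar-toTableau py px (B ᵀ) (Standard-ᵀ _ sB)) ⟨
    transposeAug (shStar (toTableau (((∞ , (px , py)) ∷ B) ᵀ)))
      ≡⟨ cong (transposeAug ∘ shStar ∘ toTableau)
              (trans (cong _ᵀ (sym eq)) (sym (rowTableau-reverse w dw))) ⟩
    transposeAug (shStar (toTableau (rowTableau (L.reverse w))))
      ≡⟨ cong (transposeAug ∘ shStar)
              (P≡toTableau (L.reverse w) (Unique-↭ (Perm.↭-sym (PermP.↭-reverse w)) dw)) ⟨
    transposeAug (shStar (P (L.reverse w)))
      ≡⟨ cong (transposeAug ∘ shStar ∘ P) (word-reverse m m′ σ len) ⟨
    transposeAug (augPlancherel m′ (L.reverse σ)) ∎
    where
    open ≡-Reasoning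
    sB = subst Standard eq s

lemma3p8 : (m m' : ℕ) →
    map (augPlancherel m) (perms (upTo (m + m')))
      ↭ map (λ σ → transposeAug (augPlancherel m' σ)) (perms (upTo (m + m')))
lemma3p8 m m' = begin
  map (augPlancherel m) (perms l)            ≡⟨ LP.map-cong-local pointwise ⟩
  map (Λᵀ ∘ L.reverse) (perms l)             ≡⟨ LP.map-∘ (perms l) ⟩
  map Λᵀ (map L.reverse (perms l))           ↭⟨ PermP.map⁺ Λᵀ (perms-reverse l) ⟩
  map Λᵀ (perms l)                           ∎
  where
  open Perm.PermutationReasoning
  l = upTo (m + m')
  Λᵀ = λ σ → transposeAug (augPlancherel m' σ)
  pointwise : All (λ σ → augPlancherel m σ ≡ Λᵀ (L.reverse σ)) (perms l)
  pointwise = All.map (λ {σ} σ↭l → augPlancherel-reverse m m' σ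
                                     (Unique-↭ (Perm.↭-sym σ↭l) (UniqueP.upTo⁺ (m + m')))
                                     (trans (PermP.↭-length σ↭l) (LP.length-upTo (m + m'))))
                      (perms-↭ l)
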